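{- $\text{E-HA}^{\omega*}_{\mathrm{st}} + \mathsf{OS}^* \vdash \mathsf{LLPO}^{\mathrm{st}}$, where $\mathsf{OS}^*$ is the schema $\forall^{\mathrm{st}} s:\sigma^* \, \varphi(s) \to \exists s:\sigma^* \,(\mathrm{hyper}_\sigma(s) \land \varphi(s))$ (all types $\sigma$, all internal $\varphi$) and $\mathsf{LLPO}^{\mathrm{st}}$ is the schema $\forall^{\mathrm{st}} x,y:\sigma \,(\varphi(x) \lor \psi(y)) \to (\forall^{\mathrm{st}} x:\sigma \, \varphi(x) \lor \forall^{\mathrm{st}} x:\sigma \, \psi(x))$ for all types $\sigma$ and internal formulae $\varphi,\psi$.
   Context: $\text{E-HA}^{\omega*}$ is extensional Heyting arithmetic in all finite types over the types generated by $0$, $\sigma\to\tau$ and $\sigma^*$ (finite sequences), with constants for the empty sequence $\langle\rangle$, prepending $C$, a list recursor, and the axiom that every sequence is empty or of the form $Cxs'$; $|s|$, $s_i$, $s\cdot t$ denote length, projection, concatenation, and $a\in s :\equiv \exists i<|s|\,(a=s_i)$. $\text{E-HA}^{\omega*}_{\mathrm{st}}$ adds predicates $\mathrm{st}_\sigma$ and external quantifiers $\forall^{\mathrm{st}}x\,\Phi :\leftrightarrow \forall x(\mathrm{st}(x)\to\Phi)$, $\exists^{\mathrm{st}}x\,\Phi :\leftrightarrow \exists x(\mathrm{st}(x)\land\Phi)$; internal formulae are those not containing $\mathrm{st}$ (lowercase Greek letters). Axioms: those of $\text{E-HA}^{\omega*}$ (induction only for internal formulae), $\mathrm{st}(x)\land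 x=y\to\mathrm{st}(y)$, $\mathrm{st}(a)$ for closed terms $a$, $\mathrm{st}(f)\land\mathrm{st}(x)\to\mathrm{st}(fx)$, and external induction $(\Phi(0)\land\forall^{\mathrm{st}}x:0(\Phi(x)\to\Phi(\mathrm{S}x)))\to\forall^{\mathrm{st}}x:0\,\Phi(x)$ for all formulae. $\mathrm{hyper}_\sigma(s) :\equiv \forall^{\mathrm{st}}x:\sigma\,(x\in s)$. -}

module Defs where

open import Data.List using (List; []; _∷_; map)
open import Data.List.Membership.Propositional using (_∈_)

infixr 5 _⇒_
data Ty : Set where
  ι   : Ty
  _⇒_ : Ty → Ty → Ty
  _✶  : Ty → Ty

Ctx : Set
Ctx = List Ty

data _∋_ : Ctx → Ty → Set where
  here  : ∀ {Γ σ} → (σ ∷ Γ) ∋ σ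
  there : ∀ {Γ σ τ} → Γ ∋ σ → (τ ∷ Γ) ∋ σ

data Tm (Γ : Ctx) : Ty → Set where
  var  : ∀ {σ} → Γ ∋ σ → Tm Γ σ
  lam  : ∀ {σ τ} → Tm (σ ∷ Γ) τ → Tm Γ (σ ⇒ τ)
  app  : ∀ {σ τ} → Tm Γ (σ ⇒ τ) → Tm Γ σ → Tm Γ τ
  zer  : Tm Γ ι
  suc  : Tm Γ (ι ⇒ ι)
  -- Gödel recursor: R a f 0 = a, R a f (S n) = f n (R a f n)
  rec  : ∀ σ → Tm Γ (σ ⇒ (ι ⇒ σ ⇒ σ) ⇒ ι ⇒ σ)
  nil  : ∀ σ → Tm Γ (σ ✶)
  cons : ∀ σ → Tm Γ (σ ⇒ σ ✶ ⇒ σ ✶)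
  -- list recursor: L a f ⟨⟩ = a, L a f (C x s) = f x s (L a f s)
  lrec : ∀ σ τ → Tm Γ (τ ⇒ (σ ⇒ σ ✶ ⇒ τ ⇒ τ) ⇒ σ ✶ ⇒ τ)

Ren : Ctx → Ctx → Set
Ren Γ Δ = ∀ {σ} → Γ ∋ σ → Δ ∋ σ

liftR : ∀ {Γ Δ τ} → Ren Γ Δ → Ren (τ ∷ Γ) (τ ∷ Δ)
liftR ρ here      = here
liftR ρ (there x) = there (ρ x)

renTm : ∀ {Γ Δ σ} → Ren Γ Δ → Tm Γ σ → Tm Δ σ
renTm ρ (var x)      = var (ρ x)
renTm ρ (lam t)      = lam (renTm (liftR ρ) t)
renTm ρ (app t u)    = app (renTm ρ t) (renTm ρ u)
renTm ρ zer          = zer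
renTm ρ suc          = suc
renTm ρ (rec σ)      = rec σ
renTm ρ (nil σ)      = nil σ
renTm ρ (cons σ)     = cons σ
renTm ρ (lrec σ τ)   = lrec σ τ

wkTm : ∀ {Γ σ τ} → Tm Γ σ → Tm (τ ∷ Γ) σ
wkTm = renTm there

Sub : Ctx → Ctx → Set
Sub Γ Δ = ∀ {σ} → Γ ∋ σ → Tm Δ σ

liftS : ∀ {Γ Δ τ} → Sub Γ Δ → Sub (τ ∷ Γ) (τ ∷ Δ)
liftS θ here      = var here
liftS θ (there x) = wkTm (θ x)

subTm : ∀ {Γ Δ σ} → Sub Γ Δ → Tm Γ σ → Tm Δ σ
subTm θ (var x)      = θ x
subTm θ (lam t)      = lam (subTm (liftS θ) t)
subTm θ (app t u)    = app (subTm θ t) (subTm θ u)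
subTm θ zer          = zer
subTm θ suc          = suc
subTm θ (rec σ)      = rec σ
subTm θ (nil σ)      = nil σ
subTm θ (cons σ)     = cons σ
subTm θ (lrec σ τ)   = lrec σ τ

single : ∀ {Γ σ} → Tm Γ σ → Sub (σ ∷ Γ) Γ
single t here      = t
single t (there x) = var x

_[_]t : ∀ {Γ σ τ} → Tm (σ ∷ Γ) τ → Tm Γ σ → Tm Γ τ
t [ u ]t = subTm (single u) t

closeR : ∀ {Γ} → Ren [] Γ
closeR ()

infixr 4 _⊃_
infixr 5 _∨'_
infixr 6 _∧'_
infix  7 _≐_

data Fm (Γ : Ctx) : Set where
  _≐_  : ∀ {σ} → Tm Γ σ → Tm Γ σ → Fm Γ
  st   : ∀ {σ} → Tm Γ σ → Fm Γ
  ⊥'   : Fm Γ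
  _∧'_ : Fm Γ → Fm Γ → Fm Γ
  _∨'_ : Fm Γ → Fm Γ → Fm Γ
  _⊃_  : Fm Γ → Fm Γ → Fm Γ
  all  : ∀ σ → Fm (σ ∷ Γ) → Fm Γ
  ex   : ∀ σ → Fm (σ ∷ Γ) → Fm Γ

data Internal {Γ : Ctx} : Fm Γ → Set where
  i-eq  : ∀ {σ} {t u : Tm Γ σ} → Internal (t ≐ u)
  i-bot : Internal ⊥'
  i-and : ∀ {A B} → Internal A → Internal B → Internal (A ∧' B)
  i-or  : ∀ {A B} → Internal A → Internal B → Internal (A ∨' B)
  i-imp : ∀ {A B} → Internal A → Internal B → Internal (A ⊃ B)
  i-all : ∀ {σ} {A : Fm (σ ∷ Γ)} → Internal A → Internal (all σ A)
  i-ex  : ∀ {σ} {A : Fm (σ ∷ Γ)} → Internal A → Internal (ex σ A)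

renFm : ∀ {Γ Δ} → Ren Γ Δ → Fm Γ → Fm Δ
renFm ρ (t ≐ u)  = renTm ρ t ≐ renTm ρ u
renFm ρ (st t)   = st (renTm ρ t)
renFm ρ ⊥'       = ⊥'
renFm ρ (A ∧' B) = renFm ρ A ∧' renFm ρ B
renFm ρ (A ∨' B) = renFm ρ A ∨' renFm ρ B
renFm ρ (A ⊃ B)  = renFm ρ A ⊃ renFm ρ B
renFm ρ (all σ A) = all σ (renFm (liftR ρ) A)
renFm ρ (ex σ A)  = ex σ (renFm (liftR ρ) A)

wkFm : ∀ {Γ τ} → Fm Γ → Fm (τ ∷ Γ)
wkFm = renFm there

subFm : ∀ {Γ Δ} → Sub Γ Δ → Fm Γ → Fm Δ
subFm θ (t ≐ u)  = subTm θ t ≐ subTm θ u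
subFm θ (st t)   = st (subTm θ t)
subFm θ ⊥'       = ⊥'
subFm θ (A ∧' B) = subFm θ A ∧' subFm θ B
subFm θ (A ∨' B) = subFm θ A ∨' subFm θ B
subFm θ (A ⊃ B)  = subFm θ A ⊃ subFm θ B
subFm θ (all σ A) = all σ (subFm (liftS θ) A)
subFm θ (ex σ A)  = ex σ (subFm (liftS θ) A)

_[_] : ∀ {Γ σ} → Fm (σ ∷ Γ) → Tm Γ σ → Fm Γ
A [ t ] = subFm (single t) A

¬' : ∀ {Γ} → Fm Γ → Fm Γ
¬' A = A ⊃ ⊥'

allSt : ∀ {Γ} σ → Fm (σ ∷ Γ) → Fm Γ
allSt σ A = all σ (st (var here) ⊃ A)

exSt : ∀ {Γ} σ → Fm (σ ∷ Γ) → Fm Γ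
exSt σ A = ex σ (st (var here) ∧' A)

app2 : ∀ {Γ σ τ ρ} → Tm Γ (σ ⇒ τ ⇒ ρ) → Tm Γ σ → Tm Γ τ → Tm Γ ρ
app2 f a b = app (app f a) b

app3 : ∀ {Γ σ τ ρ κ} → Tm Γ (σ ⇒ τ ⇒ ρ ⇒ κ) → Tm Γ σ → Tm Γ τ → Tm Γ ρ → Tm Γ κ
app3 f a b c = app (app (app f a) b) c

S' : ∀ {Γ} → Tm Γ ι → Tm Γ ι
S' n = app suc n

zeroTm : ∀ {Γ} σ → Tm Γ σ
zeroTm ι       = zer
zeroTm (σ ⇒ τ) = lam (zeroTm τ)
zeroTm (σ ✶)   = nil σ

plus : ∀ {Γ} → Tm Γ ι → Tm Γ ι → Tm Γ ι
plus m n = app3 (rec ι) m (lam (lam (S' (var here)))) n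

_<'_ : ∀ {Γ} → Tm Γ ι → Tm Γ ι → Fm Γ
i <' n = ex ι (plus (wkTm i) (S' (var here)) ≐ wkTm n)

len : ∀ {Γ σ} → Tm Γ (σ ✶) → Tm Γ ι
len {σ = σ} s = app3 (lrec σ ι) zer (lam (lam (lam (S' (var here))))) s

-- projection s_i := L (λ i. 0_σ) (λ x s' r i. R x (λ j _. r j) i) s i
-- (so (C x s')_0 = x, (C x s')_{j+1} = s'_j, and s_i = 0_σ for i ≥ |s|)
proj : ∀ {Γ σ} → Tm Γ (σ ✶) → Tm Γ ι → Tm Γ σ
proj {σ = σ} s i =
  app (app3 (lrec σ (ι ⇒ σ))
              (lam (zeroTm σ))
              (lam (lam (lam (lam
                 (app3 (rec σ)
                       (var (there (there (there here))))
                       (lam (lam (app (var (there (there (there here))))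
                                      (var (there here)))))
                       (var here))))))
              s)
      i

_∈'_ : ∀ {Γ σ} → Tm Γ σ → Tm Γ (σ ✶) → Fm Γ
a ∈' s = ex ι ((var here <' len (wkTm s)) ∧' (wkTm a ≐ proj (wkTm s) (var here)))

hyper : ∀ {Γ} σ → Tm Γ (σ ✶) → Fm Γ
hyper σ s = allSt σ (var here ∈' wkTm s)

-- Axioms of E-HA^{ω*}_st (schemas; free variables act as parameters)

data EHAst : ∀ {Γ} → Fm Γ → Set where
  eq-refl  : ∀ {Γ σ} (t : Tm Γ σ) → EHAst (t ≐ t)
  eq-subst : ∀ {Γ σ} (A : Fm (σ ∷ Γ)) → Internal A → (t u : Tm Γ σ) →
             EHAst (t ≐ u ⊃ A [ t ] ⊃ A [ u ])
  ext      : ∀ {Γ σ τ} (f g : Tm Γ (σ ⇒ τ)) →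
             EHAst (all σ (app (wkTm f) (var here) ≐ app (wkTm g) (var here)) ⊃ f ≐ g)
  beta     : ∀ {Γ σ τ} (t : Tm (σ ∷ Γ) τ) (u : Tm Γ σ) → EHAst (app (lam t) u ≐ t [ u ]t)
  suc-ne-0 : ∀ {Γ} (n : Tm Γ ι) → EHAst (¬' (S' n ≐ zer))
  suc-inj  : ∀ {Γ} (n m : Tm Γ ι) → EHAst (S' n ≐ S' m ⊃ n ≐ m)
  rec-0    : ∀ {Γ σ} (a : Tm Γ σ) (f : Tm Γ (ι ⇒ σ ⇒ σ)) →
             EHAst (app3 (rec σ) a f zer ≐ a)
  rec-S    : ∀ {Γ σ} (a : Tm Γ σ) (f : Tm Γ (ι ⇒ σ ⇒ σ)) (n : Tm Γ ι) →
             EHAst (app3 (rec σ) a f (S' n) ≐ app2 f n (app3 (rec σ) a f n))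
  ind      : ∀ {Γ} (A : Fm (ι ∷ Γ)) → Internal A →
             EHAst (A [ zer ] ⊃ all ι (A ⊃ renFm (liftR there) A [ S' (var here) ]) ⊃ all ι A)
  lrec-nil  : ∀ {Γ σ τ} (a : Tm Γ τ) (f : Tm Γ (σ ⇒ σ ✶ ⇒ τ ⇒ τ)) →
              EHAst (app3 (lrec σ τ) a f (nil σ) ≐ a)
  lrec-cons : ∀ {Γ σ τ} (a : Tm Γ τ) (f : Tm Γ (σ ⇒ σ ✶ ⇒ τ ⇒ τ)) (x : Tm Γ σ) (s : Tm Γ (σ ✶)) →
              EHAst (app3 (lrec σ τ) a f (app2 (cons σ) x s)
                     ≐ app3 f x s (app3 (lrec σ τ) a f s))
  seq-cases : ∀ {Γ σ} (s : Tm Γ (σ ✶)) →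
              EHAst (s ≐ nil σ ∨' ex σ (ex (σ ✶)
                       (wkTm (wkTm s) ≐ app2 (cons σ) (var (there here)) (var here))))
  st-eq    : ∀ {Γ σ} (t u : Tm Γ σ) → EHAst (st t ∧' t ≐ u ⊃ st u)
  st-closed : ∀ {Γ σ} (a : Tm [] σ) → EHAst {Γ} (st (renTm closeR a))
  st-app   : ∀ {Γ σ τ} (f : Tm Γ (σ ⇒ τ)) (x : Tm Γ σ) → EHAst (st f ∧' st x ⊃ st (app f x))
  ext-ind  : ∀ {Γ} (A : Fm (ι ∷ Γ)) →
             EHAst (A [ zer ] ⊃ allSt ι (A ⊃ renFm (liftR there) A [ S' (var here) ]) ⊃ allSt ι A)

data OSstar : ∀ {Γ} → Fm Γ → Set where
  os : ∀ {Γ} σ (A : Fm ((σ ✶) ∷ Γ)) → Internal A →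
       OSstar (allSt (σ ✶) A ⊃ ex (σ ✶) (hyper σ (var here) ∧' A))

data EHAst+OS : ∀ {Γ} → Fm Γ → Set where
  base : ∀ {Γ} {A : Fm Γ} → EHAst A → EHAst+OS A
  os*  : ∀ {Γ} {A : Fm Γ} → OSstar A → EHAst+OS A

data Pf (T : ∀ {Γ} → Fm Γ → Set) : (Γ : Ctx) → List (Fm Γ) → Fm Γ → Set where
  axm : ∀ {Γ Hs A} → T A → Pf T Γ Hs A
  hyp : ∀ {Γ Hs A} → A ∈ Hs → Pf T Γ Hs A
  ⊥E  : ∀ {Γ Hs A} → Pf T Γ Hs ⊥' → Pf T Γ Hs A
  ∧I  : ∀ {Γ Hs A B} → Pf T Γ Hs A → Pf T Γ Hs B → Pf T Γ Hs (A ∧' B)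
  ∧E₁ : ∀ {Γ Hs A B} → Pf T Γ Hs (A ∧' B) → Pf T Γ Hs A
  ∧E₂ : ∀ {Γ Hs A B} → Pf T Γ Hs (A ∧' B) → Pf T Γ Hs B
  ∨I₁ : ∀ {Γ Hs A B} → Pf T Γ Hs A → Pf T Γ Hs (A ∨' B)
  ∨I₂ : ∀ {Γ Hs A B} → Pf T Γ Hs B → Pf T Γ Hs (A ∨' B)
  ∨E  : ∀ {Γ Hs A B C} → Pf T Γ Hs (A ∨' B) →
        Pf T Γ (A ∷ Hs) C → Pf T Γ (B ∷ Hs) C → Pf T Γ Hs C
  ⊃I  : ∀ {Γ Hs A B} → Pf T Γ (A ∷ Hs) B → Pf T Γ Hs (A ⊃ B)
  ⊃E  : ∀ {Γ Hs A B} → Pf T Γ Hs (A ⊃ B) → Pf T Γ Hs A → Pf T Γ Hs B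
  ∀I  : ∀ {Γ Hs σ A} → Pf T (σ ∷ Γ) (map wkFm Hs) A → Pf T Γ Hs (all σ A)
  ∀E  : ∀ {Γ Hs σ A} → Pf T Γ Hs (all σ A) → (t : Tm Γ σ) → Pf T Γ Hs (A [ t ])
  ∃I  : ∀ {Γ Hs σ A} (t : Tm Γ σ) → Pf T Γ Hs (A [ t ]) → Pf T Γ Hs (ex σ A)
  ∃E  : ∀ {Γ Hs σ A C} → Pf T Γ Hs (ex σ A) →
        Pf T (σ ∷ Γ) (A ∷ map wkFm Hs) (wkFm C) → Pf T Γ Hs C

_⊢_ : (∀ {Γ} → Fm Γ → Set) → ∀ {Γ} → Fm Γ → Set
T ⊢ A = Pf T _ [] A

LLPOst : ∀ {Γ} σ → Fm (σ ∷ Γ) → Fm (σ ∷ Γ) → Fm Γ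
LLPOst σ φ ψ =
  allSt σ (allSt σ (wkFm φ ∨' renFm (liftR there) ψ))
  ⊃ (allSt σ φ ∨' allSt σ ψ)

-- Assume ∀^st x,y (φ(x) ∨ ψ(y)).  For a sequence s let χ(s) say that all
-- entries of s satisfy φ or all of them satisfy ψ; χ is internal.  Every
-- standard s satisfies χ, by two applications of bounded distribution
-- (if A(i) ∨ B for every standard i, then (∀ i < n. A(i)) ∨ B for every
-- standard n; external induction on n), using that |s| and the entries s_i of
-- a standard s are standard.  OS* then yields a hyperfinite s with χ(s), and as
-- every standard x is an entry of a hyperfinite s, ∀^st x φ(x) or ∀^st x ψ(x).

module Submission where

open import Data.List using (List; []; _∷_; map)
open import Data.List.Relation.Unary.Any using (here; there)
open import Relation.Binary.PropositionalEquality
  using (_≡_; refl; sym; trans; cong; cong₂; subst; module ≡-Reasoning)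

open import Defs hiding (here; there)
open import Defs using () renaming (here to vz; there to vs)

infix 4 _≈ₛ_
_≈ₛ_ : ∀ {Γ Δ} → Sub Γ Δ → Sub Γ Δ → Set
_≈ₛ_ {Γ} θ θ' = ∀ {τ} (x : Γ ∋ τ) → θ x ≡ θ' x

liftS-cong : ∀ {Γ Δ τ} {θ θ' : Sub Γ Δ} → θ ≈ₛ θ' → liftS {τ = τ} θ ≈ₛ liftS θ'
liftS-cong e vz     = refl
liftS-cong e (vs x) = cong wkTm (e x)

subTm-cong : ∀ {Γ Δ σ} {θ θ' : Sub Γ Δ} → θ ≈ₛ θ' → (t : Tm Γ σ) → subTm θ t ≡ subTm θ' t
subTm-cong e (var x)    = e x
subTm-cong e (lam t)    = cong lam (subTm-cong (liftS-cong e) t)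
subTm-cong e (app t u)  = cong₂ app (subTm-cong e t) (subTm-cong e u)
subTm-cong e zer        = refl
subTm-cong e suc        = refl
subTm-cong e (rec σ)    = refl
subTm-cong e (nil σ)    = refl
subTm-cong e (cons σ)   = refl
subTm-cong e (lrec σ τ) = refl

renTm-as-sub : ∀ {Γ Δ σ} (ρ : Ren Γ Δ) (t : Tm Γ σ) → renTm ρ t ≡ subTm (λ x → var (ρ x)) t
renTm-as-sub ρ (var x)    = refl
renTm-as-sub ρ (lam t)    =
  cong lam (trans (renTm-as-sub (liftR ρ) t) (subTm-cong (λ { vz → refl ; (vs x) → refl }) t))
renTm-as-sub ρ (app t u)  = cong₂ app (renTm-as-sub ρ t) (renTm-as-sub ρ u)
renTm-as-sub ρ zer        = refl
renTm-as-sub ρ suc        = refl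
renTm-as-sub ρ (rec σ)    = refl
renTm-as-sub ρ (nil σ)    = refl
renTm-as-sub ρ (cons σ)   = refl
renTm-as-sub ρ (lrec σ τ) = refl

subTm-renTm : ∀ {Γ Δ Ε σ} (θ : Sub Δ Ε) (ρ : Ren Γ Δ) (t : Tm Γ σ) →
              subTm θ (renTm ρ t) ≡ subTm (λ x → θ (ρ x)) t
subTm-renTm θ ρ (var x)    = refl
subTm-renTm θ ρ (lam t)    =
  cong lam (trans (subTm-renTm (liftS θ) (liftR ρ) t) (subTm-cong (λ { vz → refl ; (vs x) → refl }) t))
subTm-renTm θ ρ (app t u)  = cong₂ app (subTm-renTm θ ρ t) (subTm-renTm θ ρ u)
subTm-renTm θ ρ zer        = refl
subTm-renTm θ ρ suc        = refl
subTm-renTm θ ρ (rec σ)    = refl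
subTm-renTm θ ρ (nil σ)    = refl
subTm-renTm θ ρ (cons σ)   = refl
subTm-renTm θ ρ (lrec σ τ) = refl

renTm-wk : ∀ {Γ Δ σ τ} (ρ : Ren Γ Δ) (t : Tm Γ σ) → renTm (liftR {τ = τ} ρ) (wkTm t) ≡ wkTm (renTm ρ t)
renTm-wk ρ t = begin
  renTm (liftR ρ) (wkTm t)                    ≡⟨ renTm-as-sub (liftR ρ) (wkTm t) ⟩
  subTm (λ x → var (liftR ρ x)) (wkTm t)      ≡⟨ subTm-renTm _ vs t ⟩
  subTm (λ x → var (vs (ρ x))) t              ≡⟨ sym (subTm-renTm _ ρ t) ⟩
  subTm (λ x → var (vs x)) (renTm ρ t)        ≡⟨ sym (renTm-as-sub vs (renTm ρ t)) ⟩
  wkTm (renTm ρ t)                            ∎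
  where open ≡-Reasoning

renTm-subTm : ∀ {Γ Δ Ε σ} (ρ : Ren Δ Ε) (θ : Sub Γ Δ) (t : Tm Γ σ) →
              renTm ρ (subTm θ t) ≡ subTm (λ x → renTm ρ (θ x)) t
renTm-subTm ρ θ (var x)    = refl
renTm-subTm ρ θ (lam t)    =
  cong lam (trans (renTm-subTm (liftR ρ) (liftS θ) t)
                  (subTm-cong (λ { vz → refl ; (vs x) → renTm-wk ρ (θ x) }) t))
renTm-subTm ρ θ (app t u)  = cong₂ app (renTm-subTm ρ θ t) (renTm-subTm ρ θ u)
renTm-subTm ρ θ zer        = refl
renTm-subTm ρ θ suc        = refl
renTm-subTm ρ θ (rec σ)    = refl
renTm-subTm ρ θ (nil σ)    = refl
renTm-subTm ρ θ (cons σ)   = refl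
renTm-subTm ρ θ (lrec σ τ) = refl

subTm-wk : ∀ {Γ Δ σ τ} (θ : Sub Γ Δ) (t : Tm Γ σ) → subTm (liftS {τ = τ} θ) (wkTm t) ≡ wkTm (subTm θ t)
subTm-wk θ t = trans (subTm-renTm (liftS θ) vs t) (sym (renTm-subTm vs θ t))

liftS-comp : ∀ {Γ Δ Ε τ} (θ : Sub Δ Ε) (θ' : Sub Γ Δ) →
             (λ {κ} (x : (τ ∷ Γ) ∋ κ) → subTm (liftS θ) (liftS θ' x)) ≈ₛ liftS (λ x → subTm θ (θ' x))
liftS-comp θ θ' vz     = refl
liftS-comp θ θ' (vs x) = subTm-wk θ (θ' x)

subTm-subTm : ∀ {Γ Δ Ε σ} (θ : Sub Δ Ε) (θ' : Sub Γ Δ) (t : Tm Γ σ) →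
              subTm θ (subTm θ' t) ≡ subTm (λ x → subTm θ (θ' x)) t
subTm-subTm θ θ' (var x)    = refl
subTm-subTm θ θ' (lam t)    =
  cong lam (trans (subTm-subTm (liftS θ) (liftS θ') t) (subTm-cong (liftS-comp θ θ') t))
subTm-subTm θ θ' (app t u)  = cong₂ app (subTm-subTm θ θ' t) (subTm-subTm θ θ' u)
subTm-subTm θ θ' zer        = refl
subTm-subTm θ θ' suc        = refl
subTm-subTm θ θ' (rec σ)    = refl
subTm-subTm θ θ' (nil σ)    = refl
subTm-subTm θ θ' (cons σ)   = refl
subTm-subTm θ θ' (lrec σ τ) = refl

subTm-var : ∀ {Γ σ} (t : Tm Γ σ) → subTm var t ≡ t
subTm-var (var x)    = refl
subTm-var (lam t)    = cong lam (trans (subTm-cong (λ { vz → refl ; (vs x) → refl }) t) (subTm-var t))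
subTm-var (app t u)  = cong₂ app (subTm-var t) (subTm-var u)
subTm-var zer        = refl
subTm-var suc        = refl
subTm-var (rec σ)    = refl
subTm-var (nil σ)    = refl
subTm-var (cons σ)   = refl
subTm-var (lrec σ τ) = refl

single-wk : ∀ {Γ σ τ} (u : Tm Γ τ) (t : Tm Γ σ) → wkTm t [ u ]t ≡ t
single-wk u t = trans (subTm-renTm (single u) vs t) (subTm-var t)

subFm-cong : ∀ {Γ Δ} {θ θ' : Sub Γ Δ} → θ ≈ₛ θ' → (A : Fm Γ) → subFm θ A ≡ subFm θ' A
subFm-cong e (t ≐ u)   = cong₂ _≐_ (subTm-cong e t) (subTm-cong e u)
subFm-cong e (st t)    = cong st (subTm-cong e t)
subFm-cong e ⊥'        = refl
subFm-cong e (A ∧' B)  = cong₂ _∧'_ (subFm-cong e A) (subFm-cong e B)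
subFm-cong e (A ∨' B)  = cong₂ _∨'_ (subFm-cong e A) (subFm-cong e B)
subFm-cong e (A ⊃ B)   = cong₂ _⊃_ (subFm-cong e A) (subFm-cong e B)
subFm-cong e (all σ A) = cong (all σ) (subFm-cong (liftS-cong e) A)
subFm-cong e (ex σ A)  = cong (ex σ) (subFm-cong (liftS-cong e) A)

renFm-as-sub : ∀ {Γ Δ} (ρ : Ren Γ Δ) (A : Fm Γ) → renFm ρ A ≡ subFm (λ x → var (ρ x)) A
renFm-as-sub ρ (t ≐ u)   = cong₂ _≐_ (renTm-as-sub ρ t) (renTm-as-sub ρ u)
renFm-as-sub ρ (st t)    = cong st (renTm-as-sub ρ t)
renFm-as-sub ρ ⊥'        = refl
renFm-as-sub ρ (A ∧' B)  = cong₂ _∧'_ (renFm-as-sub ρ A) (renFm-as-sub ρ B)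
renFm-as-sub ρ (A ∨' B)  = cong₂ _∨'_ (renFm-as-sub ρ A) (renFm-as-sub ρ B)
renFm-as-sub ρ (A ⊃ B)   = cong₂ _⊃_ (renFm-as-sub ρ A) (renFm-as-sub ρ B)
renFm-as-sub ρ (all σ A) =
  cong (all σ) (trans (renFm-as-sub (liftR ρ) A) (subFm-cong (λ { vz → refl ; (vs x) → refl }) A))
renFm-as-sub ρ (ex σ A)  =
  cong (ex σ) (trans (renFm-as-sub (liftR ρ) A) (subFm-cong (λ { vz → refl ; (vs x) → refl }) A))

subFm-subFm : ∀ {Γ Δ Ε} (θ : Sub Δ Ε) (θ' : Sub Γ Δ) (A : Fm Γ) →
              subFm θ (subFm θ' A) ≡ subFm (λ x → subTm θ (θ' x)) A
subFm-subFm θ θ' (t ≐ u)   = cong₂ _≐_ (subTm-subTm θ θ' t) (subTm-subTm θ θ' u)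
subFm-subFm θ θ' (st t)    = cong st (subTm-subTm θ θ' t)
subFm-subFm θ θ' ⊥'        = refl
subFm-subFm θ θ' (A ∧' B)  = cong₂ _∧'_ (subFm-subFm θ θ' A) (subFm-subFm θ θ' B)
subFm-subFm θ θ' (A ∨' B)  = cong₂ _∨'_ (subFm-subFm θ θ' A) (subFm-subFm θ θ' B)
subFm-subFm θ θ' (A ⊃ B)   = cong₂ _⊃_ (subFm-subFm θ θ' A) (subFm-subFm θ θ' B)
subFm-subFm θ θ' (all σ A) =
  cong (all σ) (trans (subFm-subFm (liftS θ) (liftS θ') A) (subFm-cong (liftS-comp θ θ') A))
subFm-subFm θ θ' (ex σ A)  =
  cong (ex σ) (trans (subFm-subFm (liftS θ) (liftS θ') A) (subFm-cong (liftS-comp θ θ') A))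

subFm-var : ∀ {Γ} (A : Fm Γ) → subFm var A ≡ A
subFm-var (t ≐ u)   = cong₂ _≐_ (subTm-var t) (subTm-var u)
subFm-var (st t)    = cong st (subTm-var t)
subFm-var ⊥'        = refl
subFm-var (A ∧' B)  = cong₂ _∧'_ (subFm-var A) (subFm-var B)
subFm-var (A ∨' B)  = cong₂ _∨'_ (subFm-var A) (subFm-var B)
subFm-var (A ⊃ B)   = cong₂ _⊃_ (subFm-var A) (subFm-var B)
subFm-var (all σ A) = cong (all σ) (trans (subFm-cong (λ { vz → refl ; (vs x) → refl }) A) (subFm-var A))
subFm-var (ex σ A)  = cong (ex σ) (trans (subFm-cong (λ { vz → refl ; (vs x) → refl }) A) (subFm-var A))

subFm-internal : ∀ {Γ Δ} (θ : Sub Γ Δ) {A : Fm Γ} → Internal A → Internal (subFm θ A)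
subFm-internal θ i-eq        = i-eq
subFm-internal θ i-bot       = i-bot
subFm-internal θ (i-and a b) = i-and (subFm-internal θ a) (subFm-internal θ b)
subFm-internal θ (i-or a b)  = i-or (subFm-internal θ a) (subFm-internal θ b)
subFm-internal θ (i-imp a b) = i-imp (subFm-internal θ a) (subFm-internal θ b)
subFm-internal θ (i-all a)   = i-all (subFm-internal (liftS θ) a)
subFm-internal θ (i-ex a)    = i-ex (subFm-internal (liftS θ) a)

renFm-internal : ∀ {Γ Δ} (ρ : Ren Γ Δ) {A : Fm Γ} → Internal A → Internal (renFm ρ A)
renFm-internal ρ {A} iA = subst Internal (sym (renFm-as-sub ρ A)) (subFm-internal _ iA)

sub-sub≈ : ∀ {Γ Δ Ε} {θ : Sub Δ Ε} {θ' : Sub Γ Δ} {θ'' : Sub Γ Ε} (A : Fm Γ) →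
           (λ x → subTm θ (θ' x)) ≈ₛ θ'' → subFm θ (subFm θ' A) ≡ subFm θ'' A
sub-sub≈ {θ = θ} {θ'} A e = trans (subFm-subFm θ θ' A) (subFm-cong e A)

sub-ren≈ : ∀ {Γ Δ Ε} {θ : Sub Δ Ε} {ρ : Ren Γ Δ} {θ' : Sub Γ Ε} (A : Fm Γ) →
           (λ x → θ (ρ x)) ≈ₛ θ' → subFm θ (renFm ρ A) ≡ subFm θ' A
sub-ren≈ {ρ = ρ} A e = trans (cong (subFm _) (renFm-as-sub ρ A)) (sub-sub≈ A e)

ren-sub≈ : ∀ {Γ Δ Ε} {ρ : Ren Δ Ε} {θ : Sub Γ Δ} {θ' : Sub Γ Ε} (A : Fm Γ) →
           (λ x → renTm ρ (θ x)) ≈ₛ θ' → renFm ρ (subFm θ A) ≡ subFm θ' A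
ren-sub≈ {ρ = ρ} {θ} A e =
  trans (renFm-as-sub ρ (subFm θ A)) (sub-sub≈ A (λ x → trans (sym (renTm-as-sub ρ (θ x))) (e x)))

ren-ren≈ : ∀ {Γ Δ Ε} {ρ : Ren Δ Ε} {ρ' : Ren Γ Δ} {θ : Sub Γ Ε} (A : Fm Γ) →
           (λ x → var (ρ (ρ' x))) ≈ₛ θ → renFm ρ (renFm ρ' A) ≡ subFm θ A
ren-ren≈ {ρ = ρ} {ρ'} A e = trans (renFm-as-sub ρ (renFm ρ' A)) (sub-ren≈ A e)

renFm-renFm : ∀ {Γ Δ Ε} (ρ : Ren Δ Ε) (ρ' : Ren Γ Δ) (A : Fm Γ) →
              renFm ρ (renFm ρ' A) ≡ renFm (λ x → ρ (ρ' x)) A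
renFm-renFm ρ ρ' A = trans (ren-ren≈ A (λ _ → refl)) (sym (renFm-as-sub _ A))

sub-ren-ren≈ : ∀ {Γ Δ Δ' Ε} {θ : Sub Δ' Ε} {ρ : Ren Δ Δ'} {ρ' : Ren Γ Δ} {θ' : Sub Γ Ε} (A : Fm Γ) →
               (λ x → θ (ρ (ρ' x))) ≈ₛ θ' → subFm θ (renFm ρ (renFm ρ' A)) ≡ subFm θ' A
sub-ren-ren≈ {ρ = ρ} {ρ'} A e = trans (cong (subFm _) (renFm-renFm ρ ρ' A)) (sub-ren≈ A e)

sub₂ : ∀ {Γ τ κ} → Tm Γ τ → Tm Γ κ → Sub (κ ∷ τ ∷ Γ) Γ
sub₂ t u vz           = u
sub₂ t u (vs vz)      = t
sub₂ t u (vs (vs x))  = var x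

sub₂-single : ∀ {Γ τ κ} (B : Fm (κ ∷ τ ∷ Γ)) (t : Tm Γ τ) (u : Tm Γ κ) →
              subFm (liftS (single t)) B [ u ] ≡ subFm (sub₂ t u) B
sub₂-single B t u = sub-sub≈ B (λ { vz → refl ; (vs vz) → single-wk u t ; (vs (vs x)) → refl })

sub-ren-id : ∀ {Γ Δ} {θ : Sub Δ Γ} {ρ : Ren Γ Δ} (A : Fm Γ) →
             (λ x → θ (ρ x)) ≈ₛ var → subFm θ (renFm ρ A) ≡ A
sub-ren-id A e = trans (sub-ren≈ A e) (subFm-var A)

rebind : ∀ {Γ τ} (A : Fm (τ ∷ Γ)) → renFm (liftR vs) A [ var vz ] ≡ A
rebind A = sub-ren-id A (λ { vz → refl ; (vs x) → refl })

inst : ∀ {Γ Δ σ} → Fm (σ ∷ Γ) → Ren Γ Δ → Tm Δ σ → Fm Δ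
inst α ρ t = subFm (λ { vz → t ; (vs x) → var (ρ x) }) α

inst-ren : ∀ {Γ Δ Ε σ} (α : Fm (σ ∷ Γ)) {ρ : Ren Γ Δ} (ρ' : Ren Δ Ε) {t : Tm Δ σ} {t' : Tm Ε σ} →
           renTm ρ' t ≡ t' → renFm ρ' (inst α ρ t) ≡ inst α (λ x → ρ' (ρ x)) t'
inst-ren α ρ' e = ren-sub≈ α (λ { vz → e ; (vs x) → refl })

inst-sub : ∀ {Γ Δ Ε σ} (α : Fm (σ ∷ Γ)) {ρ : Ren Γ Δ} {ρ' : Ren Γ Ε} (θ : Sub Δ Ε) {t : Tm Δ σ} {t' : Tm Ε σ} →
           subTm θ t ≡ t' → (∀ {τ} (x : Γ ∋ τ) → θ (ρ x) ≡ var (ρ' x)) →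
           subFm θ (inst α ρ t) ≡ inst α ρ' t'
inst-sub α θ e e' = sub-sub≈ α (λ { vz → e ; (vs x) → e' x })

ballLt : ∀ {Γ} → Tm Γ ι → Fm (ι ∷ Γ) → Fm Γ
ballLt n A = all ι ((var vz <' wkTm n) ⊃ A)

disjPremise : ∀ {Γ σ} → Fm (σ ∷ Γ) → Fm (σ ∷ Γ) → Fm Γ
disjPremise {σ = σ} φ ψ = allSt σ (allSt σ (wkFm φ ∨' renFm (liftR vs) ψ))

entry : ∀ {Γ σ} → Fm (σ ∷ Γ) → Fm (ι ∷ σ ✶ ∷ Γ)
entry α = inst α (λ x → vs (vs x)) (proj (var (vs vz)) (var vz))

allEntries : ∀ {Γ σ} → Fm (σ ∷ Γ) → Fm (σ ✶ ∷ Γ)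
allEntries α = ballLt (len (var vz)) (entry α)

-- The closed functions λs.|s| and λs i.s_i of Defs, so that |s| and s_i are
-- definitionally their applications.
lenFn : ∀ {Γ σ} → Tm Γ (σ ✶ ⇒ ι)
lenFn {σ = σ} = app2 (lrec σ ι) zer (lam (lam (lam (S' (var vz)))))

projStep : ∀ {Γ σ} → Tm Γ (σ ⇒ σ ✶ ⇒ (ι ⇒ σ) ⇒ ι ⇒ σ)
projStep {σ = σ} =
  lam (lam (lam (lam (app3 (rec σ) (var (vs (vs (vs vz))))
                                   (lam (lam (app (var (vs (vs (vs vz)))) (var (vs vz)))))
                                   (var vz)))))

projFn : ∀ {Γ σ} → Tm Γ (σ ✶ ⇒ ι ⇒ σ)
projFn {σ = σ} = app2 (lrec σ (ι ⇒ σ)) (lam (zeroTm σ)) projStep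

zeroTm-sub : ∀ {Γ Δ} (θ : Sub Γ Δ) τ → subTm θ (zeroTm τ) ≡ zeroTm τ
zeroTm-sub θ ι       = refl
zeroTm-sub θ (a ⇒ b) = cong lam (zeroTm-sub (liftS θ) b)
zeroTm-sub θ (a ✶)   = refl

projFn-sub : ∀ {Γ Δ σ} (θ : Sub Γ Δ) → subTm θ (projFn {σ = σ}) ≡ projFn
projFn-sub {σ = σ} θ = cong (λ d → app2 (lrec σ (ι ⇒ σ)) (lam d) projStep) (zeroTm-sub (liftS θ) σ)

projFn-ren : ∀ {Γ Δ σ} (ρ : Ren Γ Δ) → renTm ρ (projFn {σ = σ}) ≡ projFn
projFn-ren ρ = trans (renTm-as-sub ρ projFn) (projFn-sub _)

proj-ren : ∀ {Γ Δ σ} (ρ : Ren Γ Δ) (s : Tm Γ (σ ✶)) (i : Tm Γ ι) →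
           renTm ρ (proj s i) ≡ proj (renTm ρ s) (renTm ρ i)
proj-ren ρ s i = cong (λ f → app2 f (renTm ρ s) (renTm ρ i)) (projFn-ren ρ)

pattern #0 = here refl
pattern #1 = there #0
pattern #2 = there #1
pattern #3 = there #2

module Rules {T : ∀ {Γ} → Fm Γ → Set} (embed : ∀ {Γ} {A : Fm Γ} → EHAst A → T A) where

  ax : ∀ {Γ Hs} {A : Fm Γ} → EHAst A → Pf T Γ Hs A
  ax a = axm (embed a)

  conv : ∀ {Γ Hs} {A B : Fm Γ} → A ≡ B → Pf T Γ Hs A → Pf T Γ Hs B
  conv = subst (Pf T _ _)

  rewriteBy : ∀ {Γ Hs τ} (A : Fm (τ ∷ Γ)) → Internal A → {t u : Tm Γ τ} →
              Pf T Γ Hs (t ≐ u) → Pf T Γ Hs (A [ t ]) → Pf T Γ Hs (A [ u ])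
  rewriteBy A iA {t} {u} p q = ⊃E (⊃E (ax (eq-subst A iA t u)) p) q

  ∀E₂ : ∀ {Γ Hs τ κ} {B : Fm (κ ∷ τ ∷ Γ)} → Pf T Γ Hs (all τ (all κ B)) → (t : Tm Γ τ) (u : Tm Γ κ) →
        Pf T Γ Hs (subFm (sub₂ t u) B)
  ∀E₂ {B = B} p t u = conv (sub₂-single B t u) (∀E (∀E p t) u)

  ∨-swap : ∀ {Γ Hs} {A B : Fm Γ} → Pf T Γ Hs (A ∨' B) → Pf T Γ Hs (B ∨' A)
  ∨-swap p = ∨E p (∨I₂ (hyp #0)) (∨I₁ (hyp #0))

  ≐-refl : ∀ {Γ Hs τ} (t : Tm Γ τ) → Pf T Γ Hs (t ≐ t)
  ≐-refl t = ax (eq-refl t)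

  ≐-sym : ∀ {Γ Hs τ} {t u : Tm Γ τ} → Pf T Γ Hs (t ≐ u) → Pf T Γ Hs (u ≐ t)
  ≐-sym {t = t} {u} p =
    conv (cong (u ≐_) (single-wk u t))
      (rewriteBy (var vz ≐ wkTm t) i-eq p (conv (cong (t ≐_) (sym (single-wk t t))) (≐-refl t)))

  ≐-trans : ∀ {Γ Hs τ} {t u v : Tm Γ τ} → Pf T Γ Hs (t ≐ u) → Pf T Γ Hs (u ≐ v) → Pf T Γ Hs (t ≐ v)
  ≐-trans {t = t} {u} {v} p q =
    conv (cong (_≐ v) (single-wk v t))
      (rewriteBy (wkTm t ≐ var vz) i-eq q (conv (cong (_≐ u) (sym (single-wk u t))) p))

  ≐-congʳ : ∀ {Γ Hs τ κ} (f : Tm Γ (τ ⇒ κ)) {t u : Tm Γ τ} → Pf T Γ Hs (t ≐ u) → Pf T Γ Hs (app f t ≐ app f u)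
  ≐-congʳ f {t} {u} p =
    conv (cong₂ (λ g a → app g a ≐ app g u) (single-wk u f) (single-wk u t))
      (rewriteBy (app (wkTm f) (wkTm t) ≐ app (wkTm f) (var vz)) i-eq p
        (conv (sym (cong₂ (λ g a → app g a ≐ app g t) (single-wk t f) (single-wk t t))) (≐-refl (app f t))))

  ≐-congˡ : ∀ {Γ Hs τ κ} (c : Tm Γ τ) {f g : Tm Γ (τ ⇒ κ)} → Pf T Γ Hs (f ≐ g) → Pf T Γ Hs (app f c ≐ app g c)
  ≐-congˡ c {f} {g} p =
    conv (cong₂ (λ h a → app h a ≐ app g a) (single-wk g f) (single-wk g c))
      (rewriteBy (app (wkTm f) (wkTm c) ≐ app (var vz) (wkTm c)) i-eq p
        (conv (sym (cong₂ (λ h a → app h a ≐ app f a) (single-wk f f) (single-wk f c))) (≐-refl (app f c))))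

  st-app′ : ∀ {Γ Hs τ κ} {f : Tm Γ (τ ⇒ κ)} {x : Tm Γ τ} →
            Pf T Γ Hs (st f) → Pf T Γ Hs (st x) → Pf T Γ Hs (st (app f x))
  st-app′ {f = f} {x} p q = ⊃E (ax (st-app f x)) (∧I p q)

  plus-suc : ∀ {Γ Hs} (a b : Tm Γ ι) → Pf T Γ Hs (plus a (S' b) ≐ S' (plus a b))
  plus-suc a b = ≐-trans (ax (rec-S a _ b))
                  (≐-trans (≐-congˡ (plus a b) (ax (beta (lam (S' (var vz))) b)))
                           (ax (beta (S' (var vz)) (plus a b))))

  lt-zero-absurd : ∀ {Γ Hs C} (j : Tm Γ ι) → Pf T Γ Hs (j <' zer) → Pf T Γ Hs C
  lt-zero-absurd j p =
    ⊥E (∃E p (⊃E (ax (suc-ne-0 _)) (≐-trans (≐-sym (plus-suc (wkTm j) (var vz))) (hyp #0))))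

  zero-or-suc : ∀ {Γ Hs} → Pf T Γ Hs (all ι (var vz ≐ zer ∨' ex ι (var (vs vz) ≐ S' (var vz))))
  zero-or-suc =
    ⊃E (⊃E (ax (ind (var vz ≐ zer ∨' ex ι (var (vs vz) ≐ S' (var vz))) (i-or i-eq (i-ex i-eq))))
           (∨I₁ (≐-refl zer)))
       (∀I (⊃I (∨I₂ (∃I (var vz) (≐-refl _)))))

  lt-suc-cases : ∀ {Γ Hs} → Pf T Γ Hs (all ι (all ι (var (vs vz) <' S' (var vz) ⊃
                   (var (vs vz) <' var vz) ∨' (var (vs vz) ≐ var vz))))
  lt-suc-cases {Γ} = ∀I (∀I (⊃I (∃E (hyp #0) (∨E (∀E zero-or-suc (var vz)) witness-zero witness-suc))))
    where
    i n k : Tm (ι ∷ ι ∷ ι ∷ Γ) ι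
    i = var (vs (vs vz))
    n = var (vs vz)
    k = var vz
    -- k = 0: i + S 0 = S n gives S i = S n
    witness-zero : ∀ {Hs} → Pf T (ι ∷ ι ∷ ι ∷ Γ) ((k ≐ zer) ∷ (plus i (S' k) ≐ S' n) ∷ Hs)
                                  ((i <' n) ∨' (i ≐ n))
    witness-zero =
      ∨I₂ (⊃E (ax (suc-inj _ _))
            (≐-trans (≐-sym (≐-trans (plus-suc i zer) (≐-congʳ suc (ax (rec-0 _ _)))))
                     (≐-trans (≐-congʳ (app2 (rec ι) _ _) (≐-congʳ suc (≐-sym (hyp #0)))) (hyp #1))))
    -- k = S m: i + S (S m) = S n gives i + S m = n
    witness-suc : ∀ {Hs} → Pf T (ι ∷ ι ∷ ι ∷ Γ) (ex ι (wkTm k ≐ S' (var vz)) ∷ (plus i (S' k) ≐ S' n) ∷ Hs)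
                                 ((i <' n) ∨' (i ≐ n))
    witness-suc =
      ∃E (hyp #0)
        (∨I₁ (∃I (var vz)
          (⊃E (ax (suc-inj _ _))
            (≐-trans (≐-sym (plus-suc _ _))
                     (≐-trans (≐-congʳ (app2 (rec ι) _ _) (≐-congʳ suc (≐-sym (hyp #0)))) (hyp #2))))))

  lt-suc-split : ∀ {Γ Hs} (j n : Tm Γ ι) → Pf T Γ Hs (j <' S' n) → Pf T Γ Hs ((j <' n) ∨' (j ≐ n))
  lt-suc-split j n p = ⊃E (∀E₂ lt-suc-cases j n) p

  -- The induction formula is
  -- C(k) = (∀ i < k. A(i)) ∨ B; the case i = k of the step uses A(k) ∨ B.
  bounded-or : ∀ {Γ Hs} (A : Fm (ι ∷ Γ)) → Internal A → (B : Fm Γ) →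
               Pf T Γ Hs (allSt ι (A ∨' wkFm B) ⊃ allSt ι (ballLt (var vz) (renFm (liftR vs) A) ∨' wkFm B))
  bounded-or {Γ} {Hs} A iA B = ⊃I (⊃E (⊃E (ax (ext-ind C)) C-zero) (∀I (⊃I (⊃I (conv (sym C-suc) C-step)))))
    where
    A₁ : Fm (ι ∷ ι ∷ Γ)
    A₁ = renFm (liftR vs) A
    C : Fm (ι ∷ Γ)
    C = ballLt (var vz) A₁ ∨' wkFm B
    C-suc : renFm (liftR vs) C [ S' (var vz) ] ≡ ballLt (S' (var vz)) A₁ ∨' wkFm B
    C-suc = cong₂ (λ X Y → all ι ((var vz <' S' (var (vs vz))) ⊃ X) ∨' Y)
                  (trans (sub-ren-ren≈ A (λ { vz → refl ; (vs x) → refl })) (sym (renFm-as-sub (liftR vs) A)))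
                  (trans (sub-ren-ren≈ B (λ _ → refl)) (sym (renFm-as-sub vs B)))
    C-zero : Pf T Γ (allSt ι (A ∨' wkFm B) ∷ Hs) (C [ zer ])
    C-zero = ∨I₁ (∀I (⊃I (lt-zero-absurd (var vz) (hyp #0))))
    C-step : Pf T (ι ∷ Γ) (C ∷ st (var vz) ∷ map wkFm (allSt ι (A ∨' wkFm B) ∷ Hs)) (ballLt (S' (var vz)) A₁ ∨' wkFm B)
    C-step = ∨E instance-k (∨E (hyp #1) (∨I₁ (∀I (⊃I below-suc))) (∨I₂ (hyp #0))) (∨I₂ (hyp #0))
      where
      instance-k : Pf T (ι ∷ Γ) (C ∷ st (var vz) ∷ map wkFm (allSt ι (A ∨' wkFm B) ∷ Hs)) (A ∨' wkFm B)
      instance-k = conv (rebind (A ∨' wkFm B)) (⊃E (∀E (hyp #2) (var vz)) (hyp #1))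
      -- i < S k splits into i < k (use the induction hypothesis) and i = k (use A(k))
      below-suc : ∀ {Hs'} → Pf T (ι ∷ ι ∷ Γ)
                    ((var vz <' S' (var (vs vz))) ∷ wkFm (ballLt (var vz) A₁) ∷ wkFm A ∷ Hs') A₁
      below-suc = ∨E (lt-suc-split (var vz) (var (vs vz)) (hyp #0))
                     (⊃E (conv (rebind _) (∀E (hyp #2) (var vz))) (hyp #0))
                     (conv A₂-here (rewriteBy A₂ (subFm-internal _ iA) (≐-sym (hyp #0)) (conv (sym A₂-k) (hyp #3))))
        where
        A₂ : Fm (ι ∷ ι ∷ ι ∷ Γ)
        A₂ = inst A (λ x → vs (vs (vs x))) (var vz)
        A₂-here : A₂ [ var vz ] ≡ A₁
        A₂-here = trans (sub-sub≈ A (λ { vz → refl ; (vs x) → refl })) (sym (renFm-as-sub (liftR vs) A))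
        A₂-k : A₂ [ var (vs vz) ] ≡ wkFm A
        A₂-k = trans (sub-sub≈ A (λ { vz → refl ; (vs x) → refl })) (sym (renFm-as-sub vs A))

  bounded-or-at : ∀ {Γ Hs} (A : Fm (ι ∷ Γ)) → Internal A → (B : Fm Γ) (n : Tm Γ ι) →
                  Pf T Γ Hs (allSt ι (A ∨' wkFm B)) → Pf T Γ Hs (st n) → Pf T Γ Hs (ballLt n A ∨' B)
  bounded-or-at A iA B n p sn =
    conv (cong₂ (λ X Y → all ι ((var vz <' wkTm n) ⊃ X) ∨' Y)
                (sub-ren-id A (λ { vz → refl ; (vs x) → refl })) (sub-ren-id B (λ _ → refl)))
         (⊃E (∀E (⊃E (bounded-or A iA B) p) n) sn)

  st-len : ∀ {Γ Hs σ} {s : Tm Γ (σ ✶)} → Pf T Γ Hs (st s) → Pf T Γ Hs (st (len s))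
  st-len p = st-app′ (ax (st-closed lenFn)) p

  st-proj : ∀ {Γ Hs σ} {s : Tm Γ (σ ✶)} {i : Tm Γ ι} →
            Pf T Γ Hs (st s) → Pf T Γ Hs (st i) → Pf T Γ Hs (st (proj s i))
  st-proj p q = st-app′ (st-app′ (conv (cong st (projFn-ren closeR)) (ax (st-closed projFn))) p) q

  -- If s is hyperfinite and every entry of s satisfies the internal α, then so
  -- does every standard x: x is some entry s_i, and α(s_i) transfers along x = s_i.
  hyper-covers : ∀ {Γ σ Hs} (α : Fm (σ ∷ Γ)) → Internal α →
                 Pf T (σ ✶ ∷ Γ) Hs (hyper σ (var vz) ⊃ allEntries α ⊃ wkFm (allSt σ α))
  hyper-covers {Γ} {σ} {Hs} α iα =
    ⊃I (⊃I (∀I (⊃I (∃E member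
      (conv α₃-x (rewriteBy α₃ (subFm-internal _ iα) (≐-sym (∧E₂ (hyp #0))) (conv (sym α₃-entry) α-entry)))))))
    where
    Hx : List (Fm (σ ∷ σ ✶ ∷ Γ))
    Hx = st (var vz) ∷ map wkFm (allEntries α ∷ hyper σ (var vz) ∷ Hs)
    member : Pf T (σ ∷ σ ✶ ∷ Γ) Hx (var vz ∈' var (vs vz))
    member = ⊃E (conv (rebind _) (∀E (hyp #2) (var vz))) (hyp #0)
    α₃ : Fm (σ ∷ ι ∷ σ ∷ σ ✶ ∷ Γ)
    α₃ = inst α (λ x → vs (vs (vs (vs x)))) (var vz)
    entry-i : renFm (liftR vs) (entry α) ≡ inst α (λ x → vs (vs (vs x))) (proj (var (vs (vs vz))) (var vz))
    entry-i = inst-ren α (liftR vs) (proj-ren (liftR vs) _ _)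
    α₃-entry : α₃ [ proj (var (vs (vs vz))) (var vz) ] ≡ inst α (λ x → vs (vs (vs x))) (proj (var (vs (vs vz))) (var vz))
    α₃-entry = inst-sub α _ refl (λ _ → refl)
    α₃-x : α₃ [ var (vs vz) ] ≡ wkFm (renFm (liftR vs) α)
    α₃-x = trans (inst-sub α _ refl (λ _ → refl)) (sym (ren-ren≈ α (λ { vz → refl ; (vs x) → refl })))
    α-entry : Pf T (ι ∷ σ ∷ σ ✶ ∷ Γ)
                (((var vz <' len (var (vs (vs vz)))) ∧' (var (vs vz) ≐ proj (var (vs (vs vz))) (var vz))) ∷ map wkFm Hx)
                (inst α (λ x → vs (vs (vs x))) (proj (var (vs (vs vz))) (var vz)))
    α-entry = conv entry-i (⊃E (conv (rebind _) (∀E (hyp #2) (var vz))) (∧E₁ (hyp #0)))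

  premise-at : ∀ {Γ Δ Hs σ} (φ ψ : Fm (σ ∷ Γ)) (ρ : Ren Γ Δ) {a b : Tm Δ σ} →
               Pf T Δ Hs (renFm ρ (disjPremise φ ψ)) → Pf T Δ Hs (st a) → Pf T Δ Hs (st b) →
               Pf T Δ Hs (inst φ ρ a ∨' inst ψ ρ b)
  premise-at φ ψ ρ {a} {b} h sa sb =
    conv (cong₂ _∨'_ (sub-ren-ren≈ φ (λ { vz → refl ; (vs x) → refl }))
                     (sub-ren-ren≈ ψ (λ { vz → refl ; (vs x) → refl })))
         (conv (sub₂-single _ a b) (⊃E (∀E (⊃E (∀E h a) sa) b) sb))

  -- Under the LLPO premise every standard sequence s has all its entries in φ
  -- or all in ψ: by bounded-or, first for each standard j over the entries s_i
  -- (with B = φ(s_j)), then over the entries s_j (with B = all entries in ψ).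
  standard-uniform : ∀ {Γ σ Hs} (φ ψ : Fm (σ ∷ Γ)) → Internal φ → Internal ψ →
                     Pf T (σ ✶ ∷ Γ) (st (var vz) ∷ wkFm (disjPremise φ ψ) ∷ Hs) (allEntries φ ∨' allEntries ψ)
  standard-uniform {Γ} {σ} {Hs} φ ψ iφ iψ =
    bounded-or-at (entry φ) (subFm-internal _ iφ) (allEntries ψ) (len (var vz)) outer (st-len (hyp #0))
    where
    outer : Pf T (σ ✶ ∷ Γ) (st (var vz) ∷ wkFm (disjPremise φ ψ) ∷ Hs) (allSt ι (entry φ ∨' wkFm (allEntries ψ)))
    outer = ∀I (⊃I (∨-swap (bounded-or-at (renFm (liftR vs) (entry ψ)) (renFm-internal _ (subFm-internal _ iψ))
                                          (entry φ) (len (var (vs vz))) inner (st-len (hyp #1)))))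
      where
      inner : Pf T (ι ∷ σ ✶ ∷ Γ) (st (var vz) ∷ map wkFm (st (var vz) ∷ wkFm (disjPremise φ ψ) ∷ Hs))
                (allSt ι (renFm (liftR vs) (entry ψ) ∨' wkFm (entry φ)))
      inner = ∀I (⊃I (∨-swap (conv (cong₂ _∨'_ φ-j ψ-i)
                (premise-at φ ψ (λ x → vs (vs (vs x))) (conv premise-wk (hyp #3))
                            (st-proj (hyp #2) (hyp #1)) (st-proj (hyp #2) (hyp #0))))))
        where
        premise-wk : wkFm (wkFm (wkFm (disjPremise φ ψ))) ≡ renFm (λ x → vs (vs (vs x))) (disjPremise φ ψ)
        premise-wk = trans (cong wkFm (renFm-renFm vs vs _)) (renFm-renFm vs _ _)
        φ-j : inst φ (λ x → vs (vs (vs x))) (proj (var (vs (vs vz))) (var (vs vz))) ≡ wkFm (entry φ)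
        φ-j = sym (inst-ren φ vs (proj-ren vs _ _))
        ψ-i : inst ψ (λ x → vs (vs (vs x))) (proj (var (vs (vs vz))) (var vz)) ≡ renFm (liftR vs) (entry ψ)
        ψ-i = sym (inst-ren ψ (liftR vs) (proj-ren (liftR vs) _ _))

open Rules base

mainTheorem2 : ∀ {Γ : Ctx} (σ : Ty) (φ ψ : Fm (σ ∷ Γ)) → Internal φ → Internal ψ →
    EHAst+OS ⊢ LLPOst σ φ ψ
mainTheorem2 {Γ} σ φ ψ iφ iψ =
  ⊃I (∃E (⊃E (axm (os* (os σ χ iχ))) (∀I (⊃I (standard-uniform φ ψ iφ iψ))))
         (∨E (∧E₂ (hyp #0)) (∨I₁ (cover φ iφ)) (∨I₂ (cover ψ iψ))))
  where
  χ : Fm (σ ✶ ∷ Γ)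
  χ = allEntries φ ∨' allEntries ψ
  iχ : Internal χ
  iχ = i-or (i-all (i-imp (i-ex i-eq) (subFm-internal _ iφ))) (i-all (i-imp (i-ex i-eq) (subFm-internal _ iψ)))
  cover : (α : Fm (σ ∷ Γ)) → Internal α →
          Pf EHAst+OS (σ ✶ ∷ Γ) (allEntries α ∷ (hyper σ (var vz) ∧' χ) ∷ wkFm (disjPremise φ ψ) ∷ [])
             (wkFm (allSt σ α))
  cover α iα = ⊃E (⊃E (hyper-covers α iα) (∧E₁ (hyp #1))) (hyp #0)
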